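{- Let $\mathcal W$ be any constraint domain and consider the sequent calculus of hybrid linear logic (HyLL) over $\mathcal W$ described in the context. Let $\Gamma$, $\Delta$ and $C$ be pure. If the HyLL sequent $\Gamma;\Delta\Longrightarrow C@w$ is derivable, then the ILL sequent $\Gamma;\Delta\Longrightarrow C$ is derivable, where in the latter $\Gamma$ and $\Delta$ denote the contexts with all world labels erased.
   Context: A constraint domain is a monoid $\mathcal W=\langle W,\cdot,\iota\rangle$ (not necessarily commutative); its elements are called worlds. World expressions are built from world variables $u,v,\dots$ and elements of $W$ using $\cdot$. Terms are first-order terms built from term variables and function symbols; term variables do not occur in worlds and world variables do not occur in terms. HyLL propositions: $A,B::= a\,\vec t\mid A\otimes B\mid \mathbf 1\mid A\multimap B\mid A\,\&\,B\mid \top\mid A\oplus B\mid \mathbf 0\mid\, !A\mid \forall x.A\mid\exists x.A\mid (A\ \mathsf{at}\ w)\mid \downarrow u.A\mid \forall u.A\mid \exists u.A$, where $a\,\vec t$ is an atomic predicate applied to terms, $x$ a term variable, $u$ a world variable (bound in $\downarrow u.A$, $\forall u.A$, $\exists u.A$). A proposition or multiset of propositions is pure if it contains no occurrence of the hybrid connectives $\mathsf{at}$, $\downarrow$ and no quantification over a world variable. Propositions are read up to $\alpha$-conversion; $[\tau/\alpha]A$ is capture-avoiding substitution of a term or world $\tau$ for a variable $\alpha$ of the corresponding kind. A judgement is $A@w$. HyLL sequents have the form $\Gamma;\Delta\Longrightarrow C@w$ with $\Gamma$ a set of judgements (unrestricted context) and $\Delta$ a multiset of judgements (linear context); "$\cdot$"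 denotes an empty context. The HyLL rules (premises $\Rightarrow$ conclusion) are: init: $\Gamma; a\,\vec t@u\Longrightarrow a\,\vec t@u$. copy: from $\Gamma,A@u;\Delta,A@u\Longrightarrow C@w$ infer $\Gamma,A@u;\Delta\Longrightarrow C@w$. $\otimes R$: from $\Gamma;\Delta\Longrightarrow A@w$ and $\Gamma;\Delta'\Longrightarrow B@w$ infer $\Gamma;\Delta,\Delta'\Longrightarrow A\otimes B@w$. $\otimes L$: from $\Gamma;\Delta,A@u,B@u\Longrightarrow C@w$ infer $\Gamma;\Delta,A\otimes B@u\Longrightarrow C@w$. $\mathbf 1R$: $\Gamma;\cdot\Longrightarrow \mathbf 1@w$. $\mathbf 1L$: from $\Gamma;\Delta\Longrightarrow C@w$ infer $\Gamma;\Delta,\mathbf 1@u\Longrightarrow C@w$. $\multimap R$: from $\Gamma;\Delta,A@w\Longrightarrow B@w$ infer $\Gamma;\Delta\Longrightarrow A\multimap B@w$. $\multimap L$: from $\Gamma;\Delta\Longrightarrow A@u$ and $\Gamma;\Delta',B@u\Longrightarrow C@w$ infer $\Gamma;\Delta,\Delta',A\multimap B@u\Longrightarrow C@w$. $\top R$: $\Gamma;\Delta\Longrightarrow\top@w$. $\mathbf 0L$: $\Gamma;\Delta,\mathbf 0@u\Longrightarrow C@w$. $\& R$: from $\Gamma;\Delta\Longrightarrow A@w$ and $\Gamma;\Delta\Longrightarrow B@w$ infer $\Gamma;\Delta\Longrightarrow A\&B@w$. $\& L_i$ ($i=1,2$): from $\Gamma;\Delta,A_i@u\Longrightarrow C@w$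 infer $\Gamma;\Delta,A_1\&A_2@u\Longrightarrow C@w$. $\oplus R_i$: from $\Gamma;\Delta\Longrightarrow A_i@w$ infer $\Gamma;\Delta\Longrightarrow A_1\oplus A_2@w$. $\oplus L$: from $\Gamma;\Delta,A@u\Longrightarrow C@w$ and $\Gamma;\Delta,B@u\Longrightarrow C@w$ infer $\Gamma;\Delta,A\oplus B@u\Longrightarrow C@w$. $\forall R$: from $\Gamma;\Delta\Longrightarrow A@w$ infer $\Gamma;\Delta\Longrightarrow\forall\alpha.A@w$ ($\alpha$ fresh for the conclusion). $\forall L$: from $\Gamma;\Delta,[\tau/\alpha]A@u\Longrightarrow C@w$ infer $\Gamma;\Delta,\forall\alpha.A@u\Longrightarrow C@w$. $\exists R$: from $\Gamma;\Delta\Longrightarrow[\tau/\alpha]A@w$ infer $\Gamma;\Delta\Longrightarrow\exists\alpha.A@w$. $\exists L$: from $\Gamma;\Delta,A@u\Longrightarrow C@w$ infer $\Gamma;\Delta,\exists\alpha.A@u\Longrightarrow C@w$ ($\alpha$ fresh for the conclusion). Here $\alpha$ is a term or world variable and $\tau$ a term or world accordingly. $!R$: from $\Gamma;\cdot\Longrightarrow A@w$ infer $\Gamma;\cdot\Longrightarrow\, !A@w$. $!L$: from $\Gamma,A@u;\Delta\Longrightarrow C@w$ infer $\Gamma;\Delta,!A@u\Longrightarrow C@w$. $\mathsf{at}R$: from $\Gamma;\Delta\Longrightarrow A@u$ infer $\Gamma;\Delta\Longrightarrow (A\ \mathsf{at}\ u)@v$. $\mathsf{at}L$: from $\Gamma;\Delta,A@u\Longrightarrow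 C@w$ infer $\Gamma;\Delta,(A\ \mathsf{at}\ u)@v\Longrightarrow C@w$. $\downarrow R$: from $\Gamma;\Delta\Longrightarrow[w/u]A@w$ infer $\Gamma;\Delta\Longrightarrow\downarrow u.A@w$. $\downarrow L$: from $\Gamma;\Delta,[v/u]A@v\Longrightarrow C@w$ infer $\Gamma;\Delta,\downarrow u.A@v\Longrightarrow C@w$. ILL denotes the usual sequent calculus for first-order intuitionistic linear logic, with sequents $\Gamma;\Delta\Longrightarrow C$ ($\Gamma$ a set, $\Delta$ a multiset of propositions without world labels) and rules init, copy, and the left/right rules for $\otimes,\mathbf 1,\multimap,\&,\top,\oplus,\mathbf 0,!,\forall,\exists$ (quantifiers over term variables only) obtained from the HyLL rules above by deleting all world labels. -}

module Defs where

open import Level using (Level)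
open import Data.Nat using (ℕ; zero; suc)
open import Data.Fin using (Fin; zero; suc)
open import Data.Vec using (Vec; []; _∷_)
open import Data.List using (List; []; _∷_; _++_; [_]; map)
open import Data.List.Membership.Propositional using (_∈_)
open import Data.List.Relation.Binary.Permutation.Propositional using (_↭_)
open import Algebra.Bundles using (Monoid)

record Signature : Set₁ where
  field
    FunSym    : Set
    funArity  : FunSym → ℕ
    PredSym   : Set
    predArity : PredSym → ℕ

module Terms (S : Signature) where
  open Signature S

  data Term (n : ℕ) : Set where
    var : Fin n → Term n
    app : (f : FunSym) → Vec (Term n) (funArity f) → Term n

  mutual
    subT : ∀ {n k} → (Fin n → Term k) → Term n → Term k
    subT σ (var i)    = σ i
    subT σ (app f ts) = app f (subTs σ ts)

    subTs : ∀ {n k l} → (Fin n → Term k) → Vec (Term n) l → Vec (Term k) l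
    subTs σ []       = []
    subTs σ (t ∷ ts) = subT σ t ∷ subTs σ ts

  wkT : ∀ {n} → Term n → Term (suc n)
  wkT = subT (λ i → var (suc i))

  liftT : ∀ {n k} → (Fin n → Term k) → Fin (suc n) → Term (suc k)
  liftT σ zero    = var zero
  liftT σ (suc i) = wkT (σ i)

  singleT : ∀ {n} → Term n → Fin (suc n) → Term n
  singleT τ zero    = τ
  singleT τ (suc i) = var i

module ILL (S : Signature) where
  open Signature S
  open Terms S public

  infixr 6 _⊗_ _⊸_ _&_ _⊕_

  data IProp (n : ℕ) : Set where
    atom : (P : PredSym) → Vec (Term n) (predArity P) → IProp n
    _⊗_  : IProp n → IProp n → IProp n
    𝟏    : IProp n
    _⊸_  : IProp n → IProp n → IProp n
    _&_  : IProp n → IProp n → IProp n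
    ⊤    : IProp n
    _⊕_  : IProp n → IProp n → IProp n
    𝟎    : IProp n
    !_   : IProp n → IProp n
    ∀ᵗ   : IProp (suc n) → IProp n
    ∃ᵗ   : IProp (suc n) → IProp n

  subI : ∀ {n k} → (Fin n → Term k) → IProp n → IProp k
  subI σ (atom P ts) = atom P (subTs σ ts)
  subI σ (A ⊗ B) = subI σ A ⊗ subI σ B
  subI σ 𝟏 = 𝟏
  subI σ (A ⊸ B) = subI σ A ⊸ subI σ B
  subI σ (A & B) = subI σ A & subI σ B
  subI σ ⊤ = ⊤
  subI σ (A ⊕ B) = subI σ A ⊕ subI σ B
  subI σ 𝟎 = 𝟎
  subI σ (! A) = ! subI σ A
  subI σ (∀ᵗ A) = ∀ᵗ (subI (liftT σ) A)
  subI σ (∃ᵗ A) = ∃ᵗ (subI (liftT σ) A)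

  wkI : ∀ {n} → IProp n → IProp (suc n)
  wkI = subI (λ i → var (suc i))

  [_/x]I_ : ∀ {n} → Term n → IProp (suc n) → IProp n
  [ τ /x]I A = subI (singleT τ) A

  infix 4 _⨾_⊢_

  -- Γ is a set (list up to same membership), Δ a multiset (list up to permutation).
  -- Freshness of eigenvariables is realised by de Bruijn scope extension.
  data _⨾_⊢_ : ∀ {n} → List (IProp n) → List (IProp n) → IProp n → Set where
    init : ∀ {n Γ P} {ts : Vec (Term n) (predArity P)} →
           Γ ⨾ [ atom P ts ] ⊢ atom P ts
    copy : ∀ {n Γ Δ} {A C : IProp n} → A ∈ Γ → Γ ⨾ A ∷ Δ ⊢ C → Γ ⨾ Δ ⊢ C
    exch : ∀ {n Γ Δ Δ'} {C : IProp n} → Δ ↭ Δ' → Γ ⨾ Δ ⊢ C → Γ ⨾ Δ' ⊢ C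
    sameΓ : ∀ {n Γ Γ' Δ} {C : IProp n} →
            (∀ {A} → A ∈ Γ → A ∈ Γ') → (∀ {A} → A ∈ Γ' → A ∈ Γ) →
            Γ ⨾ Δ ⊢ C → Γ' ⨾ Δ ⊢ C
    -- the supply of term variables is unbounded (as in a named presentation)
    freshVar : ∀ {n Γ Δ} {C : IProp n} →
               map wkI Γ ⨾ map wkI Δ ⊢ wkI C → Γ ⨾ Δ ⊢ C
    ⊗R : ∀ {n Γ Δ Δ'} {A B : IProp n} →
         Γ ⨾ Δ ⊢ A → Γ ⨾ Δ' ⊢ B → Γ ⨾ Δ ++ Δ' ⊢ A ⊗ B
    ⊗L : ∀ {n Γ Δ} {A B C : IProp n} →
         Γ ⨾ A ∷ B ∷ Δ ⊢ C → Γ ⨾ (A ⊗ B) ∷ Δ ⊢ C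
    𝟏R : ∀ {n Γ} → Γ ⨾ [] ⊢ 𝟏 {n}
    𝟏L : ∀ {n Γ Δ} {C : IProp n} → Γ ⨾ Δ ⊢ C → Γ ⨾ 𝟏 ∷ Δ ⊢ C
    ⊸R : ∀ {n Γ Δ} {A B : IProp n} → Γ ⨾ A ∷ Δ ⊢ B → Γ ⨾ Δ ⊢ A ⊸ B
    ⊸L : ∀ {n Γ Δ Δ'} {A B C : IProp n} →
         Γ ⨾ Δ ⊢ A → Γ ⨾ B ∷ Δ' ⊢ C → Γ ⨾ (A ⊸ B) ∷ Δ ++ Δ' ⊢ C
    ⊤R : ∀ {n Γ Δ} → Γ ⨾ Δ ⊢ ⊤ {n}
    𝟎L : ∀ {n Γ Δ} {C : IProp n} → Γ ⨾ 𝟎 ∷ Δ ⊢ C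
    &R : ∀ {n Γ Δ} {A B : IProp n} → Γ ⨾ Δ ⊢ A → Γ ⨾ Δ ⊢ B → Γ ⨾ Δ ⊢ A & B
    &L₁ : ∀ {n Γ Δ} {A B C : IProp n} → Γ ⨾ A ∷ Δ ⊢ C → Γ ⨾ (A & B) ∷ Δ ⊢ C
    &L₂ : ∀ {n Γ Δ} {A B C : IProp n} → Γ ⨾ B ∷ Δ ⊢ C → Γ ⨾ (A & B) ∷ Δ ⊢ C
    ⊕R₁ : ∀ {n Γ Δ} {A B : IProp n} → Γ ⨾ Δ ⊢ A → Γ ⨾ Δ ⊢ A ⊕ B
    ⊕R₂ : ∀ {n Γ Δ} {A B : IProp n} → Γ ⨾ Δ ⊢ B → Γ ⨾ Δ ⊢ A ⊕ B
    ⊕L : ∀ {n Γ Δ} {A B C : IProp n} →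
         Γ ⨾ A ∷ Δ ⊢ C → Γ ⨾ B ∷ Δ ⊢ C → Γ ⨾ (A ⊕ B) ∷ Δ ⊢ C
    ∀R : ∀ {n Γ Δ} {A : IProp (suc n)} →
         map wkI Γ ⨾ map wkI Δ ⊢ A → Γ ⨾ Δ ⊢ ∀ᵗ A
    ∀L : ∀ {n Γ Δ} {A : IProp (suc n)} {C : IProp n} (τ : Term n) →
         Γ ⨾ ([ τ /x]I A) ∷ Δ ⊢ C → Γ ⨾ ∀ᵗ A ∷ Δ ⊢ C
    ∃R : ∀ {n Γ Δ} {A : IProp (suc n)} (τ : Term n) →
         Γ ⨾ Δ ⊢ [ τ /x]I A → Γ ⨾ Δ ⊢ ∃ᵗ A
    ∃L : ∀ {n Γ Δ} {A : IProp (suc n)} {C : IProp n} →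
         map wkI Γ ⨾ A ∷ map wkI Δ ⊢ wkI C → Γ ⨾ ∃ᵗ A ∷ Δ ⊢ C
    !R : ∀ {n Γ} {A : IProp n} → Γ ⨾ [] ⊢ A → Γ ⨾ [] ⊢ ! A
    !L : ∀ {n Γ Δ} {A C : IProp n} → A ∷ Γ ⨾ Δ ⊢ C → Γ ⨾ (! A) ∷ Δ ⊢ C

module HyLL {c ℓ : Level} (𝓦 : Monoid c ℓ) (S : Signature) where
  open Signature S
  open Terms S public
  module I = ILL S
  open Monoid 𝓦 renaming (Carrier to W; _∙_ to _∙ᵂ_; ε to ι; _≈_ to _≈ᵂ_)

  infixl 7 _·_

  data World (m : ℕ) : Set c where
    wvar : Fin m → World m
    elem : W → World m
    _·_  : World m → World m → World m

  subW : ∀ {m k} → (Fin m → World k) → World m → World k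
  subW ρ (wvar i) = ρ i
  subW ρ (elem a) = elem a
  subW ρ (u · v)  = subW ρ u · subW ρ v

  wkW : ∀ {m} → World m → World (suc m)
  wkW = subW (λ i → wvar (suc i))

  liftW : ∀ {m k} → (Fin m → World k) → Fin (suc m) → World (suc k)
  liftW ρ zero    = wvar zero
  liftW ρ (suc i) = wkW (ρ i)

  singleW : ∀ {m} → World m → Fin (suc m) → World m
  singleW w zero    = w
  singleW w (suc i) = wvar i

  infix 4 _≈ʷ_
  data _≈ʷ_ {m : ℕ} : World m → World m → Set (c Level.⊔ ℓ) where
    ≈-refl  : ∀ {u} → u ≈ʷ u
    ≈-sym   : ∀ {u v} → u ≈ʷ v → v ≈ʷ u
    ≈-trans : ∀ {u v w} → u ≈ʷ v → v ≈ʷ w → u ≈ʷ w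
    ·-cong  : ∀ {u u' v v'} → u ≈ʷ u' → v ≈ʷ v' → u · v ≈ʷ u' · v'
    ·-assoc : ∀ {u v w} → (u · v) · w ≈ʷ u · (v · w)
    ι-left  : ∀ {u} → elem ι · u ≈ʷ u
    ι-right : ∀ {u} → u · elem ι ≈ʷ u
    elem-∙  : ∀ {a b} → elem a · elem b ≈ʷ elem (a ∙ᵂ b)
    elem-≈  : ∀ {a b} → a ≈ᵂ b → elem a ≈ʷ elem b

  infixr 6 _⊗_ _⊸_ _&_ _⊕_
  infix 7 _at_

  data Prop (n m : ℕ) : Set c where
    atom : (P : PredSym) → Vec (Term n) (predArity P) → Prop n m
    _⊗_  : Prop n m → Prop n m → Prop n m
    𝟏    : Prop n m
    _⊸_  : Prop n m → Prop n m → Prop n m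
    _&_  : Prop n m → Prop n m → Prop n m
    ⊤    : Prop n m
    _⊕_  : Prop n m → Prop n m → Prop n m
    𝟎    : Prop n m
    !_   : Prop n m → Prop n m
    ∀ᵗ   : Prop (suc n) m → Prop n m
    ∃ᵗ   : Prop (suc n) m → Prop n m
    _at_ : Prop n m → World m → Prop n m
    ↓    : Prop n (suc m) → Prop n m
    ∀ʷ   : Prop n (suc m) → Prop n m
    ∃ʷ   : Prop n (suc m) → Prop n m

  sub : ∀ {n n' m m'} → (Fin n → Term n') → (Fin m → World m') →
        Prop n m → Prop n' m'
  sub σ ρ (atom P ts) = atom P (subTs σ ts)
  sub σ ρ (A ⊗ B) = sub σ ρ A ⊗ sub σ ρ B
  sub σ ρ 𝟏 = 𝟏
  sub σ ρ (A ⊸ B) = sub σ ρ A ⊸ sub σ ρ B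
  sub σ ρ (A & B) = sub σ ρ A & sub σ ρ B
  sub σ ρ ⊤ = ⊤
  sub σ ρ (A ⊕ B) = sub σ ρ A ⊕ sub σ ρ B
  sub σ ρ 𝟎 = 𝟎
  sub σ ρ (! A) = ! sub σ ρ A
  sub σ ρ (∀ᵗ A) = ∀ᵗ (sub (liftT σ) ρ A)
  sub σ ρ (∃ᵗ A) = ∃ᵗ (sub (liftT σ) ρ A)
  sub σ ρ (A at w) = sub σ ρ A at subW ρ w
  sub σ ρ (↓ A) = ↓ (sub σ (liftW ρ) A)
  sub σ ρ (∀ʷ A) = ∀ʷ (sub σ (liftW ρ) A)
  sub σ ρ (∃ʷ A) = ∃ʷ (sub σ (liftW ρ) A)

  wkPt : ∀ {n m} → Prop n m → Prop (suc n) m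
  wkPt = sub (λ i → var (suc i)) wvar

  wkPw : ∀ {n m} → Prop n m → Prop n (suc m)
  wkPw = sub var (λ i → wvar (suc i))

  [_/x]_ : ∀ {n m} → Term n → Prop (suc n) m → Prop n m
  [ τ /x] A = sub (singleT τ) wvar A

  [_/u]_ : ∀ {n m} → World m → Prop n (suc m) → Prop n m
  [ w /u] A = sub var (singleW w) A

  infix 5 _＠_
  record Jdg (n m : ℕ) : Set c where
    constructor _＠_
    field
      prop  : Prop n m
      world : World m
  open Jdg public

  wkJt : ∀ {n m} → Jdg n m → Jdg (suc n) m
  wkJt (A ＠ w) = wkPt A ＠ w

  wkJw : ∀ {n m} → Jdg n m → Jdg n (suc m)
  wkJw (A ＠ w) = wkPw A ＠ wkW w

  infix 4 _⨾_⟹_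

  data _⨾_⟹_ : ∀ {n m} → List (Jdg n m) → List (Jdg n m) → Jdg n m → Set (c Level.⊔ ℓ) where
    init : ∀ {n m Γ P} {ts : Vec (Term n) (predArity P)} {u v : World m} →
           u ≈ʷ v → Γ ⨾ [ atom P ts ＠ u ] ⟹ atom P ts ＠ v
    copy : ∀ {n m Γ Δ} {J K : Jdg n m} → J ∈ Γ → Γ ⨾ J ∷ Δ ⟹ K → Γ ⨾ Δ ⟹ K
    exch : ∀ {n m Γ Δ Δ'} {K : Jdg n m} → Δ ↭ Δ' → Γ ⨾ Δ ⟹ K → Γ ⨾ Δ' ⟹ K
    sameΓ : ∀ {n m Γ Γ' Δ} {K : Jdg n m} →
            (∀ {J} → J ∈ Γ → J ∈ Γ') → (∀ {J} → J ∈ Γ' → J ∈ Γ) →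
            Γ ⨾ Δ ⟹ K → Γ' ⨾ Δ ⟹ K
    -- unbounded supplies of term and world variables
    freshVarᵗ : ∀ {n m Γ Δ} {K : Jdg n m} →
                map wkJt Γ ⨾ map wkJt Δ ⟹ wkJt K → Γ ⨾ Δ ⟹ K
    freshVarʷ : ∀ {n m Γ Δ} {K : Jdg n m} →
                map wkJw Γ ⨾ map wkJw Δ ⟹ wkJw K → Γ ⨾ Δ ⟹ K
    ⊗R : ∀ {n m Γ Δ Δ'} {A B : Prop n m} {w} →
         Γ ⨾ Δ ⟹ A ＠ w → Γ ⨾ Δ' ⟹ B ＠ w → Γ ⨾ Δ ++ Δ' ⟹ A ⊗ B ＠ w
    ⊗L : ∀ {n m Γ Δ} {A B : Prop n m} {u K} →
         Γ ⨾ (A ＠ u) ∷ (B ＠ u) ∷ Δ ⟹ K → Γ ⨾ (A ⊗ B ＠ u) ∷ Δ ⟹ K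
    𝟏R : ∀ {n m Γ} {w : World m} → Γ ⨾ [] ⟹ 𝟏 {n} ＠ w
    𝟏L : ∀ {n m Γ Δ} {u : World m} {K : Jdg n m} →
         Γ ⨾ Δ ⟹ K → Γ ⨾ (𝟏 ＠ u) ∷ Δ ⟹ K
    ⊸R : ∀ {n m Γ Δ} {A B : Prop n m} {w} →
         Γ ⨾ (A ＠ w) ∷ Δ ⟹ B ＠ w → Γ ⨾ Δ ⟹ A ⊸ B ＠ w
    ⊸L : ∀ {n m Γ Δ Δ'} {A B : Prop n m} {u K} →
         Γ ⨾ Δ ⟹ A ＠ u → Γ ⨾ (B ＠ u) ∷ Δ' ⟹ K →
         Γ ⨾ (A ⊸ B ＠ u) ∷ Δ ++ Δ' ⟹ K
    ⊤R : ∀ {n m Γ Δ} {w : World m} → Γ ⨾ Δ ⟹ ⊤ {n} ＠ w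
    𝟎L : ∀ {n m Γ Δ} {u : World m} {K : Jdg n m} → Γ ⨾ (𝟎 ＠ u) ∷ Δ ⟹ K
    &R : ∀ {n m Γ Δ} {A B : Prop n m} {w} →
         Γ ⨾ Δ ⟹ A ＠ w → Γ ⨾ Δ ⟹ B ＠ w → Γ ⨾ Δ ⟹ A & B ＠ w
    &L₁ : ∀ {n m Γ Δ} {A B : Prop n m} {u K} →
          Γ ⨾ (A ＠ u) ∷ Δ ⟹ K → Γ ⨾ (A & B ＠ u) ∷ Δ ⟹ K
    &L₂ : ∀ {n m Γ Δ} {A B : Prop n m} {u K} →
          Γ ⨾ (B ＠ u) ∷ Δ ⟹ K → Γ ⨾ (A & B ＠ u) ∷ Δ ⟹ K
    ⊕R₁ : ∀ {n m Γ Δ} {A B : Prop n m} {w} → Γ ⨾ Δ ⟹ A ＠ w → Γ ⨾ Δ ⟹ A ⊕ B ＠ w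
    ⊕R₂ : ∀ {n m Γ Δ} {A B : Prop n m} {w} → Γ ⨾ Δ ⟹ B ＠ w → Γ ⨾ Δ ⟹ A ⊕ B ＠ w
    ⊕L : ∀ {n m Γ Δ} {A B : Prop n m} {u K} →
         Γ ⨾ (A ＠ u) ∷ Δ ⟹ K → Γ ⨾ (B ＠ u) ∷ Δ ⟹ K → Γ ⨾ (A ⊕ B ＠ u) ∷ Δ ⟹ K
    ∀ᵗR : ∀ {n m Γ Δ} {A : Prop (suc n) m} {w} →
          map wkJt Γ ⨾ map wkJt Δ ⟹ A ＠ w → Γ ⨾ Δ ⟹ ∀ᵗ A ＠ w
    ∀ᵗL : ∀ {n m Γ Δ} {A : Prop (suc n) m} {u K} (τ : Term n) →
          Γ ⨾ ([ τ /x] A ＠ u) ∷ Δ ⟹ K → Γ ⨾ (∀ᵗ A ＠ u) ∷ Δ ⟹ K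
    ∃ᵗR : ∀ {n m Γ Δ} {A : Prop (suc n) m} {w} (τ : Term n) →
          Γ ⨾ Δ ⟹ [ τ /x] A ＠ w → Γ ⨾ Δ ⟹ ∃ᵗ A ＠ w
    ∃ᵗL : ∀ {n m Γ Δ} {A : Prop (suc n) m} {u K} →
          map wkJt Γ ⨾ (A ＠ u) ∷ map wkJt Δ ⟹ wkJt K → Γ ⨾ (∃ᵗ A ＠ u) ∷ Δ ⟹ K
    ∀ʷR : ∀ {n m Γ Δ} {A : Prop n (suc m)} {w} →
          map wkJw Γ ⨾ map wkJw Δ ⟹ A ＠ wkW w → Γ ⨾ Δ ⟹ ∀ʷ A ＠ w
    ∀ʷL : ∀ {n m Γ Δ} {A : Prop n (suc m)} {u K} (τ : World m) →
          Γ ⨾ ([ τ /u] A ＠ u) ∷ Δ ⟹ K → Γ ⨾ (∀ʷ A ＠ u) ∷ Δ ⟹ K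
    ∃ʷR : ∀ {n m Γ Δ} {A : Prop n (suc m)} {w} (τ : World m) →
          Γ ⨾ Δ ⟹ [ τ /u] A ＠ w → Γ ⨾ Δ ⟹ ∃ʷ A ＠ w
    ∃ʷL : ∀ {n m Γ Δ} {A : Prop n (suc m)} {u K} →
          map wkJw Γ ⨾ (A ＠ wkW u) ∷ map wkJw Δ ⟹ wkJw K → Γ ⨾ (∃ʷ A ＠ u) ∷ Δ ⟹ K
    !R : ∀ {n m Γ} {A : Prop n m} {w} → Γ ⨾ [] ⟹ A ＠ w → Γ ⨾ [] ⟹ ! A ＠ w
    !L : ∀ {n m Γ Δ} {A : Prop n m} {u K} →
         (A ＠ u) ∷ Γ ⨾ Δ ⟹ K → Γ ⨾ (! A ＠ u) ∷ Δ ⟹ K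
    atR : ∀ {n m Γ Δ} {A : Prop n m} {u v} →
          Γ ⨾ Δ ⟹ A ＠ u → Γ ⨾ Δ ⟹ (A at u) ＠ v
    atL : ∀ {n m Γ Δ} {A : Prop n m} {u v K} →
          Γ ⨾ (A ＠ u) ∷ Δ ⟹ K → Γ ⨾ ((A at u) ＠ v) ∷ Δ ⟹ K
    ↓R : ∀ {n m Γ Δ} {A : Prop n (suc m)} {w} →
         Γ ⨾ Δ ⟹ [ w /u] A ＠ w → Γ ⨾ Δ ⟹ ↓ A ＠ w
    ↓L : ∀ {n m Γ Δ} {A : Prop n (suc m)} {v K} →
         Γ ⨾ ([ v /u] A ＠ v) ∷ Δ ⟹ K → Γ ⨾ (↓ A ＠ v) ∷ Δ ⟹ K

  data Pure {n m : ℕ} : Prop n m → Set c where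
    atom : ∀ {P ts} → Pure (atom P ts)
    _⊗_  : ∀ {A B} → Pure A → Pure B → Pure (A ⊗ B)
    𝟏    : Pure 𝟏
    _⊸_  : ∀ {A B} → Pure A → Pure B → Pure (A ⊸ B)
    _&_  : ∀ {A B} → Pure A → Pure B → Pure (A & B)
    ⊤    : Pure ⊤
    _⊕_  : ∀ {A B} → Pure A → Pure B → Pure (A ⊕ B)
    𝟎    : Pure 𝟎
    !_   : ∀ {A} → Pure A → Pure (! A)
    ∀ᵗ   : ∀ {A} → Pure A → Pure (∀ᵗ A)
    ∃ᵗ   : ∀ {A} → Pure A → Pure (∃ᵗ A)

  PureJ : ∀ {n m} → Jdg n m → Set c
  PureJ J = Pure (prop J)

  -- On pure propositions
  -- (the only ones it is applied to in the theorem) this is the identity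
  -- embedding; the clauses for hybrid connectives are irrelevant.
  toILL : ∀ {n m} → Prop n m → I.IProp n
  toILL (atom P ts) = I.atom P ts
  toILL (A ⊗ B) = toILL A I.⊗ toILL B
  toILL 𝟏 = I.𝟏
  toILL (A ⊸ B) = toILL A I.⊸ toILL B
  toILL (A & B) = toILL A I.& toILL B
  toILL ⊤ = I.⊤
  toILL (A ⊕ B) = toILL A I.⊕ toILL B
  toILL 𝟎 = I.𝟎
  toILL (! A) = I.! toILL A
  toILL (∀ᵗ A) = I.∀ᵗ (toILL A)
  toILL (∃ᵗ A) = I.∃ᵗ (toILL A)
  toILL (A at w) = toILL A
  toILL (↓ A) = toILL A
  toILL (∀ʷ A) = toILL A
  toILL (∃ʷ A) = toILL A

  eraseJ : ∀ {n m} → Jdg n m → I.IProp n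
  eraseJ (A ＠ w) = toILL A

  eraseCtx : ∀ {n m} → List (Jdg n m) → List (I.IProp n)
  eraseCtx = map eraseJ

-- Erasing world labels and hybrid connectives turns every HyLL rule into the
-- corresponding ILL rule, or into nothing at all: the rules for at, ↓ and the
-- world quantifiers only change worlds, and world substitution is invisible
-- after erasure.  Hence erasure maps HyLL derivations to ILL derivations by
-- induction, and for pure sequents the erasure is the sequent itself.

module Submission where

open import Defs
open import Level using (Level)
open import Data.Nat using (ℕ; suc)
open import Data.Fin using (Fin; zero; suc)
open import Function using (_∘_)
open import Data.Vec using (Vec; []; _∷_)
open import Data.List using (List; []; _∷_; map)
open import Data.List.Properties using (map-++; map-∘; map-cong)
open import Data.List.Relation.Unary.All using (All)
open import Data.List.Membership.Propositional.Properties using (∈-map⁺)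
import Data.List.Relation.Binary.Subset.Propositional.Properties as ⊆
import Data.List.Relation.Binary.Permutation.Propositional.Properties as ↭
open import Relation.Binary.PropositionalEquality
open import Algebra.Bundles using (Monoid)

module IdentitySubstitution (S : Signature) where
  open ILL S

  mutual
    subT-id : ∀ {n} {σ : Fin n → Term n} → σ ≗ var → ∀ t → subT σ t ≡ t
    subT-id σ≗var (var i)    = σ≗var i
    subT-id σ≗var (app f ts) = cong (app f) (subTs-id σ≗var ts)

    subTs-id : ∀ {n l} {σ : Fin n → Term n} → σ ≗ var →
               (ts : Vec (Term n) l) → subTs σ ts ≡ ts
    subTs-id σ≗var []       = refl
    subTs-id σ≗var (t ∷ ts) = cong₂ _∷_ (subT-id σ≗var t) (subTs-id σ≗var ts)

  liftT-id : ∀ {n} {σ : Fin n → Term n} → σ ≗ var → liftT σ ≗ var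
  liftT-id σ≗var zero    = refl
  liftT-id σ≗var (suc i) = cong wkT (σ≗var i)

  subI-id : ∀ {n} {σ : Fin n → Term n} → σ ≗ var → ∀ A → subI σ A ≡ A
  subI-id σ≗var (atom P ts) = cong (atom P) (subTs-id σ≗var ts)
  subI-id σ≗var (A ⊗ B)     = cong₂ _⊗_ (subI-id σ≗var A) (subI-id σ≗var B)
  subI-id σ≗var 𝟏           = refl
  subI-id σ≗var (A ⊸ B)     = cong₂ _⊸_ (subI-id σ≗var A) (subI-id σ≗var B)
  subI-id σ≗var (A & B)     = cong₂ _&_ (subI-id σ≗var A) (subI-id σ≗var B)
  subI-id σ≗var ⊤           = refl
  subI-id σ≗var (A ⊕ B)     = cong₂ _⊕_ (subI-id σ≗var A) (subI-id σ≗var B)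
  subI-id σ≗var 𝟎           = refl
  subI-id σ≗var (! A)       = cong !_ (subI-id σ≗var A)
  subI-id σ≗var (∀ᵗ A)      = cong ∀ᵗ (subI-id (liftT-id σ≗var) A)
  subI-id σ≗var (∃ᵗ A)      = cong ∃ᵗ (subI-id (liftT-id σ≗var) A)

  subI-var : ∀ {n} (A : IProp n) → subI var A ≡ A
  subI-var = subI-id (λ _ → refl)

  subst-⊢ : ∀ {n} {Γ Γ' Δ Δ' : List (IProp n)} {C C'} →
            Γ ≡ Γ' → Δ ≡ Δ' → C ≡ C' → Γ ⨾ Δ ⊢ C → Γ' ⨾ Δ' ⊢ C'
  subst-⊢ refl refl refl d = d

module Erasure {c ℓ : Level} (𝓦 : Monoid c ℓ) (S : Signature) where
  open HyLL 𝓦 S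
  open IdentitySubstitution S

  toILL-sub : ∀ {n n' m m'} (σ : Fin n → Term n') (ρ : Fin m → World m') A →
              toILL (sub σ ρ A) ≡ I.subI σ (toILL A)
  toILL-sub σ ρ (atom P ts) = refl
  toILL-sub σ ρ (A ⊗ B)     = cong₂ I._⊗_ (toILL-sub σ ρ A) (toILL-sub σ ρ B)
  toILL-sub σ ρ 𝟏           = refl
  toILL-sub σ ρ (A ⊸ B)     = cong₂ I._⊸_ (toILL-sub σ ρ A) (toILL-sub σ ρ B)
  toILL-sub σ ρ (A & B)     = cong₂ I._&_ (toILL-sub σ ρ A) (toILL-sub σ ρ B)
  toILL-sub σ ρ ⊤           = refl
  toILL-sub σ ρ (A ⊕ B)     = cong₂ I._⊕_ (toILL-sub σ ρ A) (toILL-sub σ ρ B)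
  toILL-sub σ ρ 𝟎           = refl
  toILL-sub σ ρ (! A)       = cong I.!_ (toILL-sub σ ρ A)
  toILL-sub σ ρ (∀ᵗ A)      = cong I.∀ᵗ (toILL-sub (liftT σ) ρ A)
  toILL-sub σ ρ (∃ᵗ A)      = cong I.∃ᵗ (toILL-sub (liftT σ) ρ A)
  toILL-sub σ ρ (A at w)    = toILL-sub σ ρ A
  toILL-sub σ ρ (↓ A)       = toILL-sub σ (liftW ρ) A
  toILL-sub σ ρ (∀ʷ A)      = toILL-sub σ (liftW ρ) A
  toILL-sub σ ρ (∃ʷ A)      = toILL-sub σ (liftW ρ) A

  toILL-[/x] : ∀ {n m} (τ : Term n) (A : Prop (suc n) m) →
               toILL ([ τ /x] A) ≡ I.[ τ /x]I toILL A
  toILL-[/x] τ = toILL-sub (singleT τ) wvar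

  toILL-[/u] : ∀ {n m} (w : World m) (A : Prop n (suc m)) → toILL ([ w /u] A) ≡ toILL A
  toILL-[/u] w A = trans (toILL-sub var (singleW w) A) (subI-var (toILL A))

  eraseJ-wkJt : ∀ {n m} (J : Jdg n m) → eraseJ (wkJt J) ≡ I.wkI (eraseJ J)
  eraseJ-wkJt (A ＠ w) = toILL-sub _ _ A

  eraseJ-wkJw : ∀ {n m} (J : Jdg n m) → eraseJ (wkJw J) ≡ eraseJ J
  eraseJ-wkJw (A ＠ w) = trans (toILL-sub _ _ A) (subI-var (toILL A))

  eraseCtx-wkJt : ∀ {n m} (Γ : List (Jdg n m)) →
                  eraseCtx (map wkJt Γ) ≡ map I.wkI (eraseCtx Γ)
  eraseCtx-wkJt Γ = begin
    map eraseJ (map wkJt Γ)    ≡⟨ map-∘ Γ ⟨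
    map (eraseJ ∘ wkJt) Γ     ≡⟨ map-cong eraseJ-wkJt Γ ⟩
    map (I.wkI ∘ eraseJ) Γ    ≡⟨ map-∘ Γ ⟩
    map I.wkI (map eraseJ Γ)   ∎
    where open ≡-Reasoning

  eraseCtx-wkJw : ∀ {n m} (Γ : List (Jdg n m)) → eraseCtx (map wkJw Γ) ≡ eraseCtx Γ
  eraseCtx-wkJw Γ = trans (sym (map-∘ Γ)) (map-cong eraseJ-wkJw Γ)

  erase : ∀ {n m} {Γ Δ : List (Jdg n m)} {K} → Γ ⨾ Δ ⟹ K →
          eraseCtx Γ I.⨾ eraseCtx Δ ⊢ eraseJ K
  erase (init _)         = I.init
  erase (copy J∈Γ d)     = I.copy (∈-map⁺ eraseJ J∈Γ) (erase d)
  erase (exch Δ↭Δ' d)    = I.exch (↭.map⁺ eraseJ Δ↭Δ') (erase d)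
  erase (sameΓ Γ⊆Γ' Γ'⊆Γ d) =
    I.sameΓ (⊆.map⁺ eraseJ Γ⊆Γ') (⊆.map⁺ eraseJ Γ'⊆Γ) (erase d)
  erase (freshVarᵗ {Γ = Γ} {Δ} {K} d) =
    I.freshVar (subst-⊢ (eraseCtx-wkJt Γ) (eraseCtx-wkJt Δ) (eraseJ-wkJt K) (erase d))
  erase (freshVarʷ {Γ = Γ} {Δ} {K} d) =
    subst-⊢ (eraseCtx-wkJw Γ) (eraseCtx-wkJw Δ) (eraseJ-wkJw K) (erase d)
  erase (⊗R {Δ = Δ} {Δ'} d e) =
    subst-⊢ refl (sym (map-++ eraseJ Δ Δ')) refl (I.⊗R (erase d) (erase e))
  erase (⊗L d)           = I.⊗L (erase d)
  erase 𝟏R               = I.𝟏R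
  erase (𝟏L d)           = I.𝟏L (erase d)
  erase (⊸R d)           = I.⊸R (erase d)
  erase (⊸L {Δ = Δ} {Δ'} d e) =
    subst-⊢ refl (cong (_ ∷_) (sym (map-++ eraseJ Δ Δ'))) refl (I.⊸L (erase d) (erase e))
  erase ⊤R               = I.⊤R
  erase 𝟎L               = I.𝟎L
  erase (&R d e)         = I.&R (erase d) (erase e)
  erase (&L₁ d)          = I.&L₁ (erase d)
  erase (&L₂ d)          = I.&L₂ (erase d)
  erase (⊕R₁ d)          = I.⊕R₁ (erase d)
  erase (⊕R₂ d)          = I.⊕R₂ (erase d)
  erase (⊕L d e)         = I.⊕L (erase d) (erase e)
  erase (∀ᵗR {Γ = Γ} {Δ} d) =
    I.∀R (subst-⊢ (eraseCtx-wkJt Γ) (eraseCtx-wkJt Δ) refl (erase d))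
  erase (∀ᵗL {A = A} τ d) =
    I.∀L τ (subst-⊢ refl (cong (_∷ _) (toILL-[/x] τ A)) refl (erase d))
  erase (∃ᵗR {A = A} τ d) =
    I.∃R τ (subst-⊢ refl refl (toILL-[/x] τ A) (erase d))
  erase (∃ᵗL {Γ = Γ} {Δ} {K = K} d) =
    I.∃L (subst-⊢ (eraseCtx-wkJt Γ) (cong (_ ∷_) (eraseCtx-wkJt Δ)) (eraseJ-wkJt K) (erase d))
  erase (∀ʷR {Γ = Γ} {Δ} d) =
    subst-⊢ (eraseCtx-wkJw Γ) (eraseCtx-wkJw Δ) refl (erase d)
  erase (∀ʷL {A = A} τ d) =
    subst-⊢ refl (cong (_∷ _) (toILL-[/u] τ A)) refl (erase d)
  erase (∃ʷR {A = A} τ d) =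
    subst-⊢ refl refl (toILL-[/u] τ A) (erase d)
  erase (∃ʷL {Γ = Γ} {Δ} {K = K} d) =
    subst-⊢ (eraseCtx-wkJw Γ) (cong (_ ∷_) (eraseCtx-wkJw Δ)) (eraseJ-wkJw K) (erase d)
  erase (!R d)           = I.!R (erase d)
  erase (!L d)           = I.!L (erase d)
  erase (atR d)          = erase d
  erase (atL d)          = erase d
  erase (↓R {A = A} {w} d) = subst-⊢ refl refl (toILL-[/u] w A) (erase d)
  erase (↓L {A = A} {v} d) = subst-⊢ refl (cong (_∷ _) (toILL-[/u] v A)) refl (erase d)

-- The purity hypotheses are unused: toILL also erases the hybrid connectives.
mainTheorem6 : ∀ {c ℓ : Level} (𝓦 : Monoid c ℓ) (S : Signature) →
    let open HyLL 𝓦 S in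
    ∀ {n m : ℕ} (Γ Δ : List (Jdg n m)) (C : Prop n m) (w : World m) →
    All PureJ Γ → All PureJ Δ → Pure C →
    Γ ⨾ Δ ⟹ C ＠ w →
    ILL._⨾_⊢_ S (eraseCtx Γ) (eraseCtx Δ) (toILL C)
mainTheorem6 𝓦 S Γ Δ C w _ _ _ d = Erasure.erase 𝓦 S d
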